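{- Let $G$ be a finite simple graph and $a$ a vertex of $G$. Then \[ J(G\mid a\notin W,\ N_G(a)\cap W\neq\emptyset)=y\bigl(J(G-a)-J(G\mid N_G[a]\cap W=\emptyset)\bigr). \]
   Context: For a finite simple graph $G$ and $W\subseteq V(G)$, $N_G[W]$ is the set of vertices that are in $W$ or adjacent to a vertex of $W$, and $N_G(W):=N_G[W]\setminus W$; for a vertex $a$, $N_G(a)$ is the set of neighbours of $a$ and $N_G[a]=N_G(a)\cup\{a\}$. The bivariate domination polynomial is $J(G;x,y)=J(G):=\sum_{W\subseteq V(G)} x^{|W|}y^{|N_G(W)|}$. For a condition $c(W)$ on subsets $W\subseteq V(G)$, $J(G\mid c(W))$ is the same sum taken only over those $W$ satisfying $c(W)$. $G-a$ is the graph obtained by deleting $a$. -}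

module Defs where

open import Level using (Level)
open import Data.Bool using (Bool; true; false; _∧_; _∨_; not; if_then_else_)
open import Data.Nat using (ℕ; zero; suc)
open import Data.Fin using (Fin; punchIn; _≟_)
open import Relation.Nullary.Decidable using (⌊_⌋)
open import Data.Bool.Properties using (T?)
open import Data.Fin.Subset using (Subset; _∈_; _∉_; ∣_∣)
open import Data.Vec using (Vec; []; _∷_; lookup; tabulate)
open import Data.List using (List; []; _∷_; map; _++_; filter; foldr)
open import Data.Bool using (T)
open import Relation.Binary.PropositionalEquality using (_≡_)
open import Algebra.Bundles using (CommutativeRing)

anyFin : ∀ {n} → (Fin n → Bool) → Bool
anyFin {zero}  f = false
anyFin {suc n} f = f Fin.zero ∨ anyFin (λ i → f (Fin.suc i))

record Graph (n : ℕ) : Set where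
  field
    adj   : Fin n → Fin n → Bool
    sym   : ∀ u v → adj u v ≡ adj v u
    irrefl : ∀ v → adj v v ≡ false
open Graph public

_─_ : ∀ {n} → Graph (suc n) → Fin (suc n) → Graph n
G ─ a = record
  { adj    = λ u v → adj G (punchIn a u) (punchIn a v)
  ; sym    = λ u v → sym G (punchIn a u) (punchIn a v)
  ; irrefl = λ v → irrefl G (punchIn a v) }

_∈ᵇ_ : ∀ {n} → Fin n → Subset n → Bool
v ∈ᵇ W = lookup W v

closedNbhd : ∀ {n} → Graph n → Subset n → Subset n
closedNbhd G W = tabulate λ v → (v ∈ᵇ W) ∨ anyFin (λ w → (w ∈ᵇ W) ∧ adj G w v)

openNbhd : ∀ {n} → Graph n → Subset n → Subset n
openNbhd G W = tabulate λ v → not (v ∈ᵇ W) ∧ (v ∈ᵇ closedNbhd G W)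

nbhdV : ∀ {n} → Graph n → Fin n → Subset n
nbhdV G a = tabulate λ v → adj G a v

closedNbhdV : ∀ {n} → Graph n → Fin n → Subset n
closedNbhdV G a = tabulate λ v → adj G a v ∨ ⌊ v ≟ a ⌋

meets : ∀ {n} → Subset n → Subset n → Bool
meets {n} U W = anyFin λ v → (v ∈ᵇ U) ∧ (v ∈ᵇ W)

allSubsets : (n : ℕ) → List (Subset n)
allSubsets zero    = [] ∷ []
allSubsets (suc n) = map (false ∷_) (allSubsets n) ++ map (true ∷_) (allSubsets n)

module _ {c ℓ : Level} (R : CommutativeRing c ℓ) where
  open CommutativeRing R

  pow : Carrier → ℕ → Carrier
  pow r zero    = 1#
  pow r (suc k) = r * pow r k

  Jc : ∀ {n} → Graph n → (Subset n → Bool) → Carrier → Carrier → Carrier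
  Jc {n} G cond x y =
    foldr _+_ 0# (map (λ W → pow x ∣ W ∣ * pow y ∣ openNbhd G W ∣)
                      (filter (λ W → T? (cond W)) (allSubsets n)))

  J : ∀ {n} → Graph n → Carrier → Carrier → Carrier
  J G = Jc G (λ _ → true)

module Submission where

-- Deleting a vertex a splits every W ⊆ V(G) uniquely into its trace
-- W' ⊆ V(G − a) and the bit "a ∈ W"; with subsets as Boolean vectors this is
-- W = insertAt W' a b.  Let N' be N_G(a) viewed inside V(G − a).  If a ∈ W,
-- W satisfies neither condition of the statement.  If a ∉ W, both
-- "N_G(a) ∩ W ≠ ∅" and "N_G[a] ∩ W ≠ ∅" mean N' ∩ W' ≠ ∅, and N_G(W) is
-- N_{G−a}(W') together with a exactly when N' ∩ W' ≠ ∅.  So for each W' the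
-- contribution to J(G | a ∉ W, N_G(a) ∩ W ≠ ∅) plus y times the contribution
-- to J(G | N_G[a] ∩ W = ∅) equals y x^|W'| y^|N_{G−a}(W')|; summing over W'
-- gives J(G | …) + y J(G | N_G[a] ∩ W = ∅) = y J(G − a), i.e. the theorem.

open import Defs hiding (sym)
open import Level using (Level)
open import Data.Nat using (ℕ; zero; suc)
open import Data.Fin using (Fin; punchIn; _≟_)
open import Data.Fin.Properties using (punchInᵢ≢i)
open import Data.Bool using (Bool; true; false; _∧_; _∨_; not; if_then_else_)
open import Data.Bool.Properties using (T?; ∧-comm; ∨-zeroʳ; ∨-identityʳ)
open import Data.Fin.Subset using (Subset; ∣_∣)
open import Data.Vec using (Vec; _∷_; lookup; tabulate; insertAt)
open import Data.Vec.Properties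
  using (insertAt-lookup; insertAt-punchIn; lookup∘tabulate; tabulate∘lookup; tabulate-cong)
open import Data.List using (List; []; _∷_; map; _++_; filter; foldr)
open import Relation.Nullary.Decidable using (⌊_⌋; isYes≗does; dec-true; dec-false)
open import Relation.Binary.PropositionalEquality
  using (_≡_; refl; sym; trans; cong; cong₂; module ≡-Reasoning)
open import Algebra.Bundles using (CommutativeRing)
import Algebra.Properties.CommutativeSemigroup as CommutativeSemigroupProperties
import Algebra.Properties.Group as GroupProperties
import Algebra.Properties.Ring as RingProperties
import Relation.Binary.Reasoning.Setoid as SetoidReasoning

∨-swap : ∀ b c d → b ∨ (c ∨ d) ≡ c ∨ (b ∨ d)
∨-swap true  c     d = sym (∨-zeroʳ c)
∨-swap false c     d = refl

anyFin-cong : ∀ {n} {f g : Fin n → Bool} → (∀ i → f i ≡ g i) → anyFin f ≡ anyFin g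
anyFin-cong {zero}  f≗g = refl
anyFin-cong {suc n} f≗g = cong₂ _∨_ (f≗g Fin.zero) (anyFin-cong (λ i → f≗g (Fin.suc i)))

anyFin-punchIn : ∀ {n} (a : Fin (suc n)) (f : Fin (suc n) → Bool) →
                 anyFin f ≡ f a ∨ anyFin (λ u → f (punchIn a u))
anyFin-punchIn         Fin.zero    f = refl
anyFin-punchIn {suc n} (Fin.suc a) f =
  trans (cong (f Fin.zero ∨_) (anyFin-punchIn a (λ i → f (Fin.suc i))))
        (∨-swap (f Fin.zero) (f (Fin.suc a)) _)

anyFin-insertAt : ∀ {n} (W : Subset n) (a : Fin (suc n)) (b : Bool) (g : Fin (suc n) → Bool) →
                  anyFin (λ w → lookup (insertAt W a b) w ∧ g w)
                    ≡ (b ∧ g a) ∨ anyFin (λ u → lookup W u ∧ g (punchIn a u))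
anyFin-insertAt W a b g =
  trans (anyFin-punchIn a (λ w → lookup (insertAt W a b) w ∧ g w))
        (cong₂ _∨_ (cong (_∧ g a) (insertAt-lookup W a b))
                   (anyFin-cong (λ u → cong (_∧ g (punchIn a u)) (insertAt-punchIn W a b u))))

meets-insertAt : ∀ {n} (U W : Subset n) (a : Fin (suc n)) (b c : Bool) →
                 meets (insertAt U a b) (insertAt W a c) ≡ (b ∧ c) ∨ meets U W
meets-insertAt U W a b c =
  trans (anyFin-insertAt U a b (lookup (insertAt W a c)))
        (cong₂ _∨_ (cong (b ∧_) (insertAt-lookup W a c))
                   (anyFin-cong (λ u → cong (lookup U u ∧_) (insertAt-punchIn W a c u))))

tabulate-insertAt : ∀ {A : Set} {n} (a : Fin (suc n)) (f : Fin (suc n) → A) →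
                    tabulate f ≡ insertAt (tabulate (λ u → f (punchIn a u))) a (f a)
tabulate-insertAt         Fin.zero    f = refl
tabulate-insertAt {n = suc n} (Fin.suc a) f =
  cong (f Fin.zero ∷_) (tabulate-insertAt a (λ i → f (Fin.suc i)))

insertAt-ext : ∀ {A : Set} {n} (V : Vec A (suc n)) (V' : Vec A n) (a : Fin (suc n)) (b : A) →
               lookup V a ≡ b → (∀ u → lookup V (punchIn a u) ≡ lookup V' u) →
               V ≡ insertAt V' a b
insertAt-ext V V' a b at-a off-a = begin
  V                                                      ≡⟨ sym (tabulate∘lookup V) ⟩
  tabulate (lookup V)                                    ≡⟨ tabulate-insertAt a (lookup V) ⟩
  insertAt (tabulate (λ u → lookup V (punchIn a u))) a (lookup V a)
    ≡⟨ cong₂ (λ V″ c → insertAt V″ a c) (trans (tabulate-cong off-a) (tabulate∘lookup V')) at-a ⟩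
  insertAt V' a b                                        ∎
  where open ≡-Reasoning

∣insertAt∣ : ∀ {n} (W : Subset n) (a : Fin (suc n)) (b : Bool) → ∣ insertAt W a b ∣ ≡ ∣ b ∷ W ∣
∣insertAt∣ W           Fin.zero    b     = refl
∣insertAt∣ (true ∷ W)  (Fin.suc a) true  = cong suc (∣insertAt∣ W a true)
∣insertAt∣ (true ∷ W)  (Fin.suc a) false = cong suc (∣insertAt∣ W a false)
∣insertAt∣ (false ∷ W) (Fin.suc a) true  = ∣insertAt∣ W a true
∣insertAt∣ (false ∷ W) (Fin.suc a) false = ∣insertAt∣ W a false

openNbhd-lookup : ∀ {m} (G : Graph m) (W : Subset m) (v : Fin m) →
                  lookup (openNbhd G W) v
                    ≡ not (lookup W v) ∧ (lookup W v ∨ anyFin (λ w → lookup W w ∧ adj G w v))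
openNbhd-lookup G W v =
  trans (lookup∘tabulate _ v) (cong (not (lookup W v) ∧_) (lookup∘tabulate _ v))

module Deletion {n : ℕ} (G : Graph (suc n)) (a : Fin (suc n)) where

  nbhdInDeletion : Subset n
  nbhdInDeletion = tabulate (λ u → adj G a (punchIn a u))

  nbhdInDeletion-lookup : ∀ u → lookup nbhdInDeletion u ≡ adj G a (punchIn a u)
  nbhdInDeletion-lookup = lookup∘tabulate _

  nbhdV-split : nbhdV G a ≡ insertAt nbhdInDeletion a false
  nbhdV-split = insertAt-ext _ _ a false
    (trans (lookup∘tabulate (adj G a) a) (irrefl G a))
    (λ u → trans (lookup∘tabulate (adj G a) (punchIn a u)) (sym (nbhdInDeletion-lookup u)))

  closedNbhdV-split : closedNbhdV G a ≡ insertAt nbhdInDeletion a true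
  closedNbhdV-split = insertAt-ext _ _ a true at-a off-a
    where
      inClosed : Fin (suc n) → Bool
      inClosed v = adj G a v ∨ ⌊ v ≟ a ⌋

      at-a : lookup (closedNbhdV G a) a ≡ true
      at-a = trans (lookup∘tabulate inClosed a)
                   (trans (cong (adj G a a ∨_) (trans (isYes≗does (a ≟ a)) (dec-true (a ≟ a) refl)))
                          (∨-zeroʳ _))

      off-a : ∀ u → lookup (closedNbhdV G a) (punchIn a u) ≡ lookup nbhdInDeletion u
      off-a u = trans (lookup∘tabulate inClosed (punchIn a u))
                      (trans (cong (adj G a (punchIn a u) ∨_)
                                   (trans (isYes≗does (punchIn a u ≟ a))
                                          (dec-false (punchIn a u ≟ a) (punchInᵢ≢i a u))))
                             (trans (∨-identityʳ _) (sym (nbhdInDeletion-lookup u))))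

  openNbhd-at : ∀ (W : Subset n) → lookup (openNbhd G (insertAt W a false)) a ≡ meets nbhdInDeletion W
  openNbhd-at W = begin
    lookup (openNbhd G Wf) a
      ≡⟨ openNbhd-lookup G Wf a ⟩
    not (lookup Wf a) ∧ (lookup Wf a ∨ anyFin (λ w → lookup Wf w ∧ adj G w a))
      ≡⟨ cong (λ b → not b ∧ (b ∨ anyFin (λ w → lookup Wf w ∧ adj G w a))) (insertAt-lookup W a false) ⟩
    anyFin (λ w → lookup Wf w ∧ adj G w a)
      ≡⟨ anyFin-insertAt W a false (λ w → adj G w a) ⟩
    anyFin (λ u → lookup W u ∧ adj G (punchIn a u) a)
      ≡⟨ anyFin-cong (λ u → trans (∧-comm (lookup W u) _)
                                  (cong (_∧ lookup W u)
                                        (trans (Defs.sym G (punchIn a u) a) (sym (nbhdInDeletion-lookup u))))) ⟩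
    meets nbhdInDeletion W ∎
    where
      open ≡-Reasoning
      Wf : Subset (suc n)
      Wf = insertAt W a false

  openNbhd-off : ∀ (W : Subset n) (u : Fin n) →
                 lookup (openNbhd G (insertAt W a false)) (punchIn a u) ≡ lookup (openNbhd (G ─ a) W) u
  openNbhd-off W u = begin
    lookup (openNbhd G Wf) (punchIn a u)
      ≡⟨ openNbhd-lookup G Wf (punchIn a u) ⟩
    not (lookup Wf (punchIn a u)) ∧ (lookup Wf (punchIn a u) ∨ anyFin (λ w → lookup Wf w ∧ adj G w (punchIn a u)))
      ≡⟨ cong₂ (λ b c → not b ∧ (b ∨ c)) (insertAt-punchIn W a false u)
               (anyFin-insertAt W a false (λ w → adj G w (punchIn a u))) ⟩
    not (lookup W u) ∧ (lookup W u ∨ anyFin (λ w → lookup W w ∧ adj (G ─ a) w u))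
      ≡⟨ sym (openNbhd-lookup (G ─ a) W u) ⟩
    lookup (openNbhd (G ─ a) W) u ∎
    where
      open ≡-Reasoning
      Wf : Subset (suc n)
      Wf = insertAt W a false

  openNbhd-delete : ∀ (W : Subset n) →
                    openNbhd G (insertAt W a false)
                      ≡ insertAt (openNbhd (G ─ a) W) a (meets nbhdInDeletion W)
  openNbhd-delete W = insertAt-ext _ _ a _ (openNbhd-at W) (openNbhd-off W)

  ∣openNbhd-delete∣ : ∀ (W : Subset n) →
                      ∣ openNbhd G (insertAt W a false) ∣ ≡ ∣ meets nbhdInDeletion W ∷ openNbhd (G ─ a) W ∣
  ∣openNbhd-delete∣ W = trans (cong ∣_∣ (openNbhd-delete W)) (∣insertAt∣ _ a _)

  nbhdV-meets : ∀ (W : Subset n) (b : Bool) → meets (nbhdV G a) (insertAt W a b) ≡ meets nbhdInDeletion W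
  nbhdV-meets W b =
    trans (cong (λ U → meets U (insertAt W a b)) nbhdV-split) (meets-insertAt nbhdInDeletion W a false b)

  closedNbhdV-meets : ∀ (W : Subset n) (b : Bool) →
                      meets (closedNbhdV G a) (insertAt W a b) ≡ b ∨ meets nbhdInDeletion W
  closedNbhdV-meets W b =
    trans (cong (λ U → meets U (insertAt W a b)) closedNbhdV-split) (meets-insertAt nbhdInDeletion W a true b)

module Sums {c ℓ : Level} (R : CommutativeRing c ℓ) where
  open CommutativeRing R renaming (refl to ≈-refl; sym to ≈-sym; trans to ≈-trans)
  open SetoidReasoning setoid
  open CommutativeSemigroupProperties +-commutativeSemigroup using (interchange)

  sumOver : ∀ {A : Set} → (A → Carrier) → List A → Carrier
  sumOver f xs = foldr _+_ 0# (map f xs)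

  sumOver-++ : ∀ {A : Set} (f : A → Carrier) xs ys → sumOver f (xs ++ ys) ≈ sumOver f xs + sumOver f ys
  sumOver-++ f []       ys = ≈-sym (+-identityˡ _)
  sumOver-++ f (x ∷ xs) ys = ≈-trans (+-congˡ (sumOver-++ f xs ys)) (≈-sym (+-assoc _ _ _))

  sumOver-map : ∀ {A B : Set} (f : B → Carrier) (h : A → B) xs →
                sumOver f (map h xs) ≡ sumOver (λ z → f (h z)) xs
  sumOver-map f h []       = refl
  sumOver-map f h (x ∷ xs) = cong (f (h x) +_) (sumOver-map f h xs)

  sumOver-cong : ∀ {A : Set} {f g : A → Carrier} xs → (∀ x → f x ≈ g x) → sumOver f xs ≈ sumOver g xs
  sumOver-cong []       f≈g = ≈-refl
  sumOver-cong (x ∷ xs) f≈g = +-cong (f≈g x) (sumOver-cong xs f≈g)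

  sumOver-+ : ∀ {A : Set} (f g : A → Carrier) xs →
              sumOver (λ z → f z + g z) xs ≈ sumOver f xs + sumOver g xs
  sumOver-+ f g []       = ≈-sym (+-identityˡ _)
  sumOver-+ f g (x ∷ xs) =
    ≈-trans (+-congˡ (sumOver-+ f g xs)) (interchange (f x) (g x) (sumOver f xs) (sumOver g xs))

  sumOver-* : ∀ {A : Set} (k : Carrier) (f : A → Carrier) xs → sumOver (λ z → k * f z) xs ≈ k * sumOver f xs
  sumOver-* k f []       = ≈-sym (zeroʳ k)
  sumOver-* k f (x ∷ xs) = ≈-trans (+-congˡ (sumOver-* k f xs)) (≈-sym (distribˡ k _ _))

  sumOver-filter : ∀ {A : Set} (cond : A → Bool) (f : A → Carrier) xs →
                   sumOver f (filter (λ z → T? (cond z)) xs) ≈ sumOver (λ z → if cond z then f z else 0#) xs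
  sumOver-filter cond f []       = ≈-refl
  sumOver-filter cond f (x ∷ xs) with cond x
  ... | true  = +-congˡ (sumOver-filter cond f xs)
  ... | false = ≈-trans (sumOver-filter cond f xs) (≈-sym (+-identityˡ _))

  sumSubsets : ∀ n → (Subset n → Carrier) → Carrier
  sumSubsets n f = sumOver f (allSubsets n)

  sumSubsets-head : ∀ n (f : Subset (suc n) → Carrier) →
                    sumSubsets (suc n) f ≈ sumSubsets n (λ W → f (false ∷ W)) + sumSubsets n (λ W → f (true ∷ W))
  sumSubsets-head n f = begin
    sumOver f (map (false ∷_) (allSubsets n) ++ map (true ∷_) (allSubsets n))
      ≈⟨ sumOver-++ f (map (false ∷_) (allSubsets n)) _ ⟩
    sumOver f (map (false ∷_) (allSubsets n)) + sumOver f (map (true ∷_) (allSubsets n))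
      ≡⟨ cong₂ _+_ (sumOver-map f (false ∷_) (allSubsets n)) (sumOver-map f (true ∷_) (allSubsets n)) ⟩
    sumSubsets n (λ W → f (false ∷ W)) + sumSubsets n (λ W → f (true ∷ W)) ∎

  sumSubsets-insertAt : ∀ n (a : Fin (suc n)) (f : Subset (suc n) → Carrier) →
                        sumSubsets (suc n) f ≈ sumSubsets n (λ W → f (insertAt W a false) + f (insertAt W a true))
  sumSubsets-insertAt n Fin.zero f = ≈-trans (sumSubsets-head n f) (≈-sym (sumOver-+ _ _ (allSubsets n)))
  sumSubsets-insertAt (suc n) (Fin.suc a) f = begin
    sumSubsets (suc (suc n)) f
      ≈⟨ sumSubsets-head (suc n) f ⟩
    sumSubsets (suc n) (λ W → f (false ∷ W)) + sumSubsets (suc n) (λ W → f (true ∷ W))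
      ≈⟨ +-cong (sumSubsets-insertAt n a (λ W → f (false ∷ W))) (sumSubsets-insertAt n a (λ W → f (true ∷ W))) ⟩
    sumSubsets n (λ W → f (false ∷ insertAt W a false) + f (false ∷ insertAt W a true))
      + sumSubsets n (λ W → f (true ∷ insertAt W a false) + f (true ∷ insertAt W a true))
      ≈⟨ ≈-sym (sumSubsets-head n _) ⟩
    sumSubsets (suc n) (λ W → f (insertAt W (Fin.suc a) false) + f (insertAt W (Fin.suc a) true)) ∎

  solve-for : ∀ s t u y → s + y * t ≈ y * u → s ≈ y * (u - t)
  solve-for s t u y eq = begin
    s                   ≈⟨ ≈-sym (//-rightDividesʳ (y * t) s) ⟩
    (s + y * t) - y * t ≈⟨ +-congʳ eq ⟩
    y * u - y * t       ≈⟨ ≈-sym (x[y-z]≈xy-xz y u t) ⟩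
    y * (u - t)         ∎
    where
      open GroupProperties +-group using (//-rightDividesʳ)
      open RingProperties ring using (x[y-z]≈xy-xz)

module Splitting {c ℓ : Level} (R : CommutativeRing c ℓ) {n : ℕ} (G : Graph (suc n)) (a : Fin (suc n))
                 (x y : CommutativeRing.Carrier R) where
  open CommutativeRing R renaming (refl to ≈-refl; sym to ≈-sym; trans to ≈-trans)
  open SetoidReasoning setoid
  open Sums R
  open Deletion G a

  touches avoids : Subset (suc n) → Bool
  touches W = not (a ∈ᵇ W) ∧ meets (nbhdV G a) W
  avoids  W = not (meets (closedNbhdV G a) W)

  term : ∀ {m} → Graph m → Subset m → Carrier
  term H W = pow R x ∣ W ∣ * pow R y ∣ openNbhd H W ∣

  restricted : (Subset (suc n) → Bool) → Subset n → Carrier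
  restricted cond W = (if cond (insertAt W a false) then term G (insertAt W a false) else 0#)
                    + (if cond (insertAt W a true)  then term G (insertAt W a true)  else 0#)

  asSum : ∀ cond → Jc R G cond x y ≈ sumSubsets n (restricted cond)
  asSum cond = ≈-trans (sumOver-filter cond (term G) (allSubsets (suc n)))
                     (sumSubsets-insertAt n a _)

  -- The pointwise identity, with b recording whether W meets N_G(a).
  summand-cases : ∀ b (p : Carrier) {m} (k : Subset m) →
    ((if b then p * pow R y ∣ b ∷ k ∣ else 0#) + 0#)
      + y * ((if not b then p * pow R y ∣ b ∷ k ∣ else 0#) + 0#)
      ≈ y * (p * pow R y ∣ k ∣)
  summand-cases true  p k = begin
    (p * (y * pow R y ∣ k ∣) + 0#) + y * (0# + 0#) ≈⟨ +-cong (+-identityʳ _) (≈-trans (*-congˡ (+-identityʳ 0#)) (zeroʳ y)) ⟩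
    p * (y * pow R y ∣ k ∣) + 0#                  ≈⟨ +-identityʳ _ ⟩
    p * (y * pow R y ∣ k ∣)                       ≈⟨ ≈-sym (*-assoc p y _) ⟩
    (p * y) * pow R y ∣ k ∣                       ≈⟨ *-congʳ (*-comm p y) ⟩
    (y * p) * pow R y ∣ k ∣                       ≈⟨ *-assoc y p _ ⟩
    y * (p * pow R y ∣ k ∣)                       ∎
  summand-cases false p k =
    ≈-trans (+-congʳ (+-identityˡ 0#)) (≈-trans (+-identityˡ _) (*-congˡ (+-identityʳ _)))

  summand : ∀ W → restricted touches W + y * restricted avoids W ≈ y * term (G ─ a) W
  summand W = begin
    restricted touches W + y * restricted avoids W
      ≡⟨ cong₂ (λ s t → s + y * t) (restricted-as m touches touches-without touches-with)
                                   (restricted-as (not m) avoids avoids-without avoids-with) ⟩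
    ((if m then term G Wf else 0#) + 0#) + y * ((if not m then term G Wf else 0#) + 0#)
      ≡⟨ cong (λ t → ((if m then t else 0#) + 0#) + y * ((if not m then t else 0#) + 0#)) term-without ⟩
    ((if m then T else 0#) + 0#) + y * ((if not m then T else 0#) + 0#)
      ≈⟨ summand-cases m (pow R x ∣ W ∣) (openNbhd (G ─ a) W) ⟩
    y * term (G ─ a) W ∎
    where
      m : Bool
      m = meets nbhdInDeletion W
      Wf Wt : Subset (suc n)
      Wf = insertAt W a false
      Wt = insertAt W a true
      T : Carrier
      T = pow R x ∣ W ∣ * pow R y ∣ m ∷ openNbhd (G ─ a) W ∣

      restricted-as : ∀ b cond → cond Wf ≡ b → cond Wt ≡ false →
                      restricted cond W ≡ (if b then term G Wf else 0#) + 0#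
      restricted-as b cond p q = cong₂ (λ c d → (if c then term G Wf else 0#) + (if d then term G Wt else 0#)) p q

      touches-without : touches Wf ≡ m
      touches-without = cong₂ (λ b c → not b ∧ c) (insertAt-lookup W a false) (nbhdV-meets W false)
      touches-with : touches Wt ≡ false
      touches-with = cong (λ b → not b ∧ meets (nbhdV G a) Wt) (insertAt-lookup W a true)
      avoids-without : avoids Wf ≡ not m
      avoids-without = cong not (closedNbhdV-meets W false)
      avoids-with : avoids Wt ≡ false
      avoids-with = cong not (closedNbhdV-meets W true)
      term-without : term G Wf ≡ T
      term-without = cong₂ (λ i j → pow R x i * pow R y j) (∣insertAt∣ W a false) (∣openNbhd-delete∣ W)

lemma4 : ∀ {c ℓ} (R : CommutativeRing c ℓ) {n : ℕ} (G : Graph (suc n)) (a : Fin (suc n))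
    (x y : CommutativeRing.Carrier R) →
    CommutativeRing._≈_ R
    (Jc R G (λ W → not (a ∈ᵇ W) ∧ meets (nbhdV G a) W) x y)
    (CommutativeRing._*_ R y
    (CommutativeRing._-_ R (J R (G ─ a) x y)
    (Jc R G (λ W → not (meets (closedNbhdV G a) W)) x y)))
lemma4 R {n} G a x y =
  solve-for _ _ _ y (begin
    Jc R G touches x y + y * Jc R G avoids x y
      ≈⟨ +-cong (asSum touches) (*-congˡ (asSum avoids)) ⟩
    sumSubsets n (restricted touches) + y * sumSubsets n (restricted avoids)
      ≈⟨ +-congˡ (≈-sym (sumOver-* y _ (allSubsets n))) ⟩
    sumSubsets n (restricted touches) + sumSubsets n (λ W → y * restricted avoids W)
      ≈⟨ ≈-sym (sumOver-+ _ _ (allSubsets n)) ⟩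
    sumSubsets n (λ W → restricted touches W + y * restricted avoids W)
      ≈⟨ sumOver-cong (allSubsets n) summand ⟩
    sumSubsets n (λ W → y * term (G ─ a) W)
      ≈⟨ sumOver-* y _ (allSubsets n) ⟩
    y * sumSubsets n (term (G ─ a))
      ≈⟨ *-congˡ (≈-sym (sumOver-filter (λ _ → true) (term (G ─ a)) (allSubsets n))) ⟩
    y * J R (G ─ a) x y ∎)
  where
  open CommutativeRing R renaming (refl to ≈-refl; sym to ≈-sym; trans to ≈-trans)
  open SetoidReasoning setoid
  open Sums R
  open Splitting R G a x y
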